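{- Let $n$ be a positive integer and consider the system of equations $$X^n+Y^n={X'}^n-{Y'}^n,\qquad XY=X'Y'$$ in positive integers $X,Y,X',Y'$ with $\gcd(X,Y)=\gcd(X',Y')=1$. If this system has a solution, then for that solution $XY\equiv 0 \pmod 2$. -}

-- If X Y = X′ Y′ is odd then X, Y, X′, Y′ are odd, hence so are a = Xⁿ, b = Yⁿ, c = X′ⁿ,
-- d = Y′ⁿ, and these satisfy a + b + d = c and a b = c d. Modulo 4 this is
-- impossible: once the residues of a, b, d are chosen in {1, 3}, the sum determines
-- c mod 4, and in each of the eight cases a b ≢ c d (mod 4).
module Submission where

open import Data.Nat using (ℕ; zero; suc; _+_; _*_; _%_; _>_; _^_; s≤s; NonZero)
open import Data.Nat.GCD using (gcd)
open import Data.Integer using (+_; _-_) renaming (_+_ to _+ℤ_; _*_ to _*ℤ_; _^_ to _^ℤ_)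
open import Data.Nat.Properties using (*-comm; *-commutativeSemigroup)
open import Data.Nat.DivMod using (%-distribˡ-+; %-distribˡ-*; m%n<n; m%n%n≡m%n; m∣n⇒o%n%m≡o%m)
open import Data.Nat.Divisibility using (divides)
open import Data.Integer.Properties using (pos-+; pos-*; +-injective; +-0-abelianGroup)
open import Algebra.Properties.AbelianGroup +-0-abelianGroup using (//-rightDividesˡ)
open import Algebra.Properties.CommutativeSemigroup *-commutativeSemigroup using (interchange)
open import Data.Empty using (⊥)
open import Relation.Nullary using (¬_; contradiction)
open import Relation.Binary.PropositionalEquality using (_≡_; refl; sym; trans; cong; cong₂; subst; module ≡-Reasoning)
open ≡-Reasoning

pos-^ : ∀ m n → (+ m) ^ℤ n ≡ + (m ^ n)
pos-^ m zero    = refl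
pos-^ m (suc n) = trans (cong ((+ m) *ℤ_) (pos-^ m n)) (sym (pos-* m (m ^ n)))

+m+ℤ+n≡+o-+p⇒m+n+p≡o : ∀ m n o p → + m +ℤ + n ≡ + o - + p → m + n + p ≡ o
+m+ℤ+n≡+o-+p⇒m+n+p≡o m n o p eq = +-injective (begin
  + (m + n + p)       ≡⟨ trans (pos-+ (m + n) p) (cong (_+ℤ + p) (pos-+ m n)) ⟩
  + m +ℤ + n +ℤ + p   ≡⟨ cong (_+ℤ + p) eq ⟩
  + o - + p +ℤ + p    ≡⟨ //-rightDividesˡ (+ p) (+ o) ⟩
  + o                 ∎)

^-distribʳ-* : ∀ m n k → (m * n) ^ k ≡ m ^ k * n ^ k
^-distribʳ-* m n zero    = refl
^-distribʳ-* m n (suc k) = begin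
  m * n * (m * n) ^ k      ≡⟨ cong (m * n *_) (^-distribʳ-* m n k) ⟩
  m * n * (m ^ k * n ^ k)  ≡⟨ interchange m n (m ^ k) (n ^ k) ⟩
  m * m ^ k * (n * n ^ k)  ∎

%-distribˡ-+₃ : ∀ m n o d .{{_ : NonZero d}} → (m + n + o) % d ≡ (m % d + n % d + o % d) % d
%-distribˡ-+₃ m n o d = begin
  (m + n + o) % d                        ≡⟨ %-distribˡ-+ (m + n) o d ⟩
  ((m + n) % d + o % d) % d              ≡⟨ cong (λ r → (r + o % d) % d) (%-distribˡ-+ m n d) ⟩
  ((m % d + n % d) % d + o % d) % d      ≡⟨ cong (λ r → ((m % d + n % d) % d + r) % d) (m%n%n≡m%n o d) ⟨
  ((m % d + n % d) % d + o % d % d) % d  ≡⟨ %-distribˡ-+ (m % d + n % d) (o % d) d ⟨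
  (m % d + n % d + o % d) % d            ∎

Odd : ℕ → Set
Odd m = m % 2 ≡ 1

odd-*ˡ : ∀ m n → Odd (m * n) → Odd m
odd-*ˡ m n odd with m % 2 | m%n<n m 2 | trans (sym odd) (%-distribˡ-* m n 2)
... | 0           | _             | ()
... | 1           | _             | _ = refl
... | suc (suc _) | s≤s (s≤s ()) | _

odd-*ʳ : ∀ m n → Odd (m * n) → Odd n
odd-*ʳ m n odd = odd-*ˡ n m (subst Odd (*-comm m n) odd)

odd-^ : ∀ m n → Odd m → Odd (m ^ n)
odd-^ m zero    odd = refl
odd-^ m (suc n) odd = begin
  (m * m ^ n) % 2              ≡⟨ %-distribˡ-* m (m ^ n) 2 ⟩
  (m % 2 * (m ^ n % 2)) % 2    ≡⟨ cong₂ (λ r s → (r * s) % 2) odd (odd-^ m n odd) ⟩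
  1                            ∎

data OddResidue₄ : ℕ → Set where
  one   : OddResidue₄ 1
  three : OddResidue₄ 3

odd⇒oddResidue₄ : ∀ m → Odd m → OddResidue₄ (m % 4)
odd⇒oddResidue₄ m odd with m % 4 | m%n<n m 4 | trans (m∣n⇒o%n%m≡o%m 2 4 m (divides 2 refl)) odd
... | 0                       | _                         | ()
... | 1                       | _                         | _ = one
... | 2                       | _                         | ()
... | 3                       | _                         | _ = three
... | suc (suc (suc (suc _))) | s≤s (s≤s (s≤s (s≤s ()))) | _

oddResidues₄-no-solution : ∀ {a b c d} → OddResidue₄ a → OddResidue₄ b → OddResidue₄ d
                         → (a + b + d) % 4 ≡ c → (a * b) % 4 ≡ (c * d) % 4 → ⊥
oddResidues₄-no-solution one   one   one   refl ()
oddResidues₄-no-solution one   one   three refl ()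
oddResidues₄-no-solution one   three one   refl ()
oddResidues₄-no-solution one   three three refl ()
oddResidues₄-no-solution three one   one   refl ()
oddResidues₄-no-solution three one   three refl ()
oddResidues₄-no-solution three three one   refl ()
oddResidues₄-no-solution three three three refl ()

no-odd-sum-product-solution : ∀ a b c d → Odd (a * b) → a + b + d ≡ c → a * b ≡ c * d → ⊥
no-odd-sum-product-solution a b c d ab-odd sum≡ prod≡ =
  oddResidues₄-no-solution (odd⇒oddResidue₄ a (odd-*ˡ a b ab-odd))
                           (odd⇒oddResidue₄ b (odd-*ʳ a b ab-odd))
                           (odd⇒oddResidue₄ d (odd-*ʳ c d (subst Odd prod≡ ab-odd)))
                           sum₄ prod₄
  where
  sum₄ : (a % 4 + b % 4 + d % 4) % 4 ≡ c % 4
  sum₄ = trans (sym (%-distribˡ-+₃ a b d 4)) (cong (_% 4) sum≡)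
  prod₄ : (a % 4 * (b % 4)) % 4 ≡ (c % 4 * (d % 4)) % 4
  prod₄ = trans (sym (%-distribˡ-* a b 4)) (trans (cong (_% 4) prod≡) (%-distribˡ-* c d 4))

¬odd⇒even : ∀ m → ¬ Odd m → m % 2 ≡ 0
¬odd⇒even m ¬odd with m % 2 | m%n<n m 2
... | 0           | _             = refl
... | 1           | _             = contradiction refl ¬odd
... | suc (suc _) | s≤s (s≤s ())

lemma1 : (n X Y X′ Y′ : ℕ) → n > 0 → X > 0 → Y > 0 → X′ > 0 → Y′ > 0
       → gcd X Y ≡ 1 → gcd X′ Y′ ≡ 1
       → (+ X) ^ℤ n +ℤ (+ Y) ^ℤ n ≡ (+ X′) ^ℤ n - (+ Y′) ^ℤ n
       → X * Y ≡ X′ * Y′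
       → (X * Y) % 2 ≡ 0
lemma1 n X Y X′ Y′ _ _ _ _ _ _ _ sumℤ prod = ¬odd⇒even (X * Y) λ odd →
  no-odd-sum-product-solution (X ^ n) (Y ^ n) (X′ ^ n) (Y′ ^ n)
    (subst Odd (^-distribʳ-* X Y n) (odd-^ (X * Y) n odd)) powerSum powerProd
  where
  powerSum : X ^ n + Y ^ n + Y′ ^ n ≡ X′ ^ n
  powerSum = +m+ℤ+n≡+o-+p⇒m+n+p≡o (X ^ n) (Y ^ n) (X′ ^ n) (Y′ ^ n) (begin
    + (X ^ n) +ℤ + (Y ^ n)    ≡⟨ cong₂ _+ℤ_ (pos-^ X n) (pos-^ Y n) ⟨
    (+ X) ^ℤ n +ℤ (+ Y) ^ℤ n  ≡⟨ sumℤ ⟩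
    (+ X′) ^ℤ n - (+ Y′) ^ℤ n ≡⟨ cong₂ _-_ (pos-^ X′ n) (pos-^ Y′ n) ⟩
    + (X′ ^ n) - + (Y′ ^ n)   ∎)
  powerProd : X ^ n * Y ^ n ≡ X′ ^ n * Y′ ^ n
  powerProd = begin
    X ^ n * Y ^ n      ≡⟨ ^-distribʳ-* X Y n ⟨
    (X * Y) ^ n        ≡⟨ cong (_^ n) prod ⟩
    (X′ * Y′) ^ n      ≡⟨ ^-distribʳ-* X′ Y′ n ⟩
    X′ ^ n * Y′ ^ n    ∎
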